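{- Let $\lambda,\mu,q\ge0$ and let $G$ be a graph satisfying the $(\lambda,\mu)$-bow metric. If all metric triangles of $G$ have sides of length at most $q$, then the intervals of $G$ are $p$-thin for $p\le\max\{\mu,q+2\lambda\}$.
   Context: Graphs are finite, simple, unweighted, undirected, connected, with shortest-path distance $d$. The interval is $I(u,v)=\{z: d(u,z)+d(z,v)=d(u,v)\}$; the slice is $S_k(u,v)=\{x\in I(u,v): d(u,x)=k\}$; the intervals of $G$ are $p$-thin if every slice has diameter at most $p$. Three vertices form a metric triangle if their pairwise intervals intersect only in common endpoints. A graph satisfies the $(\lambda,\mu)$-bow metric if for all vertices $u,v,w,x$ with $v\in I(u,w)$, $w\in I(v,x)$ and $d(v,w)>\lambda$, one has $d(u,x)\ge d(u,v)+d(v,w)+d(w,x)-\mu$. -}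

module Defs where

open import Data.Nat using (ℕ; zero; suc; _+_; _*_; _≤_; _<_; _⊔_)
open import Data.Fin using (Fin)
open import Data.Product using (_×_; Σ)
open import Relation.Binary.PropositionalEquality using (_≡_)
open import Relation.Nullary using (¬_)

record SimpleGraph (n : ℕ) : Set₁ where
  field
    Adj   : Fin n → Fin n → Set
    sym   : ∀ {u v} → Adj u v → Adj v u
    irrefl : ∀ {u} → ¬ Adj u u

module _ {n : ℕ} (G : SimpleGraph n) where
  open SimpleGraph G

  data Walk : Fin n → Fin n → ℕ → Set where
    nil  : ∀ {u} → Walk u u 0
    cons : ∀ {u v w k} → Adj u v → Walk v w k → Walk u w (suc k)

  -- d is the shortest-path distance of G: d u v is the length of some walk
  -- from u to v, and no walk from u to v is shorter.  (Existence of such a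
  -- d is equivalent to G being connected.)
  IsDistance : (Fin n → Fin n → ℕ) → Set
  IsDistance d = (∀ u v → Walk u v (d u v)) × (∀ u v k → Walk u v k → d u v ≤ k)

module _ {n : ℕ} (d : Fin n → Fin n → ℕ) where

  InInterval : Fin n → Fin n → Fin n → Set
  InInterval u v z = d u z + d z v ≡ d u v

  InSlice : Fin n → Fin n → ℕ → Fin n → Set
  InSlice u v k x = InInterval u v x × d u x ≡ k

  Thin : ℕ → Set
  Thin p = ∀ u v k x y → InSlice u v k x → InSlice u v k y → d x y ≤ p

  MetricTriangle : Fin n → Fin n → Fin n → Set
  MetricTriangle u v w =
      (∀ z → InInterval u v z → InInterval u w z → z ≡ u)
    × (∀ z → InInterval v u z → InInterval v w z → z ≡ v)
    × (∀ z → InInterval w u z → InInterval w v z → z ≡ w)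

  TrianglesBounded : ℕ → Set
  TrianglesBounded q = ∀ u v w → MetricTriangle u v w →
    (d u v ≤ q) × (d v w ≤ q) × (d u w ≤ q)

  -- (λ,μ)-bow metric; d(u,x) ≥ S - μ written as S ≤ d(u,x) + μ
  BowMetric : ℕ → ℕ → Set
  BowMetric l m = ∀ u v w x → InInterval u w v → InInterval v x w → l < d v w →
    d u v + d v w + d w x ≤ d u x + m

{-# OPTIONS --safe #-}
module Submission where

-- Every triple a, b, c has a quasi-median: a metric triangle a', b', c' such that
-- a–a'–b'–b, a–a'–c'–c and b–b'–c'–c lie on geodesics.  It is reached by repeatedly
-- moving a corner to a point in the intersection of its two incident intervals,
-- which strictly shrinks the perimeter.  For x, y in a slice S_k(u,v) take the
-- quasi-median u', x', y' of u, x, y.  If d(x',x) > λ, the bow metric for the chain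
-- y, x', x, v together with d(x,v) = d(y,v) forces d(x,y) ≤ μ, and symmetrically if
-- d(y',y) > λ.  Otherwise d(x,y) = d(x,x') + d(x',y') + d(y',y) ≤ λ + q + λ.

open import Defs
open import Data.Fin using (Fin)
open import Data.Fin.Properties using (any?) renaming (_≟_ to _≟ᶠ_)
open import Data.Nat using (ℕ; suc; _+_; _*_; _⊔_; _≤_; _<_; z≤n; s≤s; _<?_)
open import Data.Nat.Properties
open import Algebra.Properties.CommutativeSemigroup +-commutativeSemigroup
  using (xy∙z≈y∙xz; xy∙z≈zy∙x)
open import Data.Product using (_×_; _,_; proj₁; proj₂; ∃)
open import Data.Sum using (_⊎_; inj₁; inj₂)
open import Function using (_∘_)
open import Function.Metric.Nat using (IsMetric; module IsMetric)
open import Relation.Nullary using (yes; no)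
open import Relation.Nullary.Decidable using (_×-dec_; ¬?; decidable-stable)
open import Relation.Binary.PropositionalEquality

module _ {n : ℕ} (G : SimpleGraph n) where
  open SimpleGraph G using (Adj) renaming (sym to Adj-sym)

  _++_ : ∀ {u v w k j} → Walk G u v k → Walk G v w j → Walk G u w (k + j)
  nil      ++ q = q
  cons e p ++ q = cons e (p ++ q)

  _∷ʳ_ : ∀ {u v w k} → Walk G u v k → Adj v w → Walk G u w (suc k)
  nil      ∷ʳ e = cons e nil
  cons f p ∷ʳ e = cons f (p ∷ʳ e)

  reverse : ∀ {u v k} → Walk G u v k → Walk G v u k
  reverse nil        = nil
  reverse (cons e p) = reverse p ∷ʳ Adj-sym e

  length-zero⇒≡ : ∀ {u v} → Walk G u v 0 → u ≡ v
  length-zero⇒≡ nil = refl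

  isDistance⇒isMetric : ∀ {d} → IsDistance G d → IsMetric _≡_ d
  isDistance⇒isMetric {d} (walk , shortest) = record
    { isSemiMetric = record
      { isQuasiSemiMetric = record
        { isPreMetric = record
          { isProtoMetric = record
            { isPartialOrder  = ≤-isPartialOrder
            ; ≈-isEquivalence = isEquivalence
            ; cong            = cong₂ d
            ; nonNegative     = z≤n
            }
          ; ≈⇒0 = λ { {x} refl → n≤0⇒n≡0 (shortest x x 0 nil) }
          }
        ; 0⇒≈ = λ {x} {y} d≡0 → length-zero⇒≡ (subst (Walk G x y) d≡0 (walk x y))
        }
      ; sym = λ x y → ≤-antisym (reversed-shorter x y) (reversed-shorter y x)
      }
    ; triangle = λ x y z → shortest x z _ (walk x y ++ walk y z)
    }
    where
    reversed-shorter : ∀ x y → d x y ≤ d y x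
    reversed-shorter x y = shortest x y _ (reverse (walk y x))

module _ {n : ℕ} {d : Fin n → Fin n → ℕ} (metric : IsMetric _≡_ d) where
  open IsMetric metric using (≈⇒0; 0⇒≈; triangle) renaming (sym to d-sym)
  open ≤-Reasoning

  ∈I-sym : ∀ {u v z} → InInterval d u v z → InInterval d v u z
  ∈I-sym {u} {v} {z} z∈I = begin-equality
    d v z + d z u ≡⟨ +-comm (d v z) (d z u) ⟩
    d z u + d v z ≡⟨ cong₂ _+_ (d-sym z u) (d-sym v z) ⟩
    d u z + d z v ≡⟨ z∈I ⟩
    d u v         ≡⟨ d-sym u v ⟩
    d v u         ∎

  ∈I⇒closerˡ : ∀ {u v z} → InInterval d u v z → z ≢ u → d z v < d u v
  ∈I⇒closerˡ {u} {v} {z} z∈I z≢u =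
    subst (d z v <_) z∈I (m<n+m (d z v) (n≢0⇒n>0 (z≢u ∘ sym ∘ 0⇒≈)))

  ∈I⇒closerʳ : ∀ {u v z} → InInterval d u v z → z ≢ v → d u z < d u v
  ∈I⇒closerʳ {u} {v} {z} z∈I z≢v =
    subst (d u z <_) z∈I (m<m+n (d u z) (n≢0⇒n>0 (z≢v ∘ 0⇒≈)))

  ∈I-rebase : ∀ {u v x z} → InInterval d u x z → InInterval d u v x → InInterval d z v x
  ∈I-rebase {u} {v} {x} {z} z∈I x∈I = ≤-antisym upper (triangle z x v)
    where
    upper : d z x + d x v ≤ d z v
    upper = +-cancelˡ-≤ (d u z) _ _ (begin
      d u z + (d z x + d x v) ≡⟨ +-assoc (d u z) _ _ ⟨
      d u z + d z x + d x v   ≡⟨ cong (_+ d x v) z∈I ⟩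
      d u x + d x v           ≡⟨ x∈I ⟩
      d u v                   ≤⟨ triangle u z v ⟩
      d u z + d z v           ∎)

  Geodesic : Fin n → Fin n → Fin n → Fin n → Set
  Geodesic p q r s = d p q + d q r + d r s ≡ d p s

  geodesic-trivial : ∀ a b → Geodesic a a b b
  geodesic-trivial a b = begin-equality
    d a a + d a b + d b b ≡⟨ cong₂ (λ s t → s + d a b + t) (≈⇒0 refl) (≈⇒0 refl) ⟩
    d a b + 0             ≡⟨ +-identityʳ (d a b) ⟩
    d a b                 ∎

  geodesic-reverse : ∀ {p q r s} → Geodesic p q r s → Geodesic s r q p
  geodesic-reverse {p} {q} {r} {s} g = begin-equality
    d s r + d r q + d q p ≡⟨ cong₂ _+_ (cong₂ _+_ (d-sym s r) (d-sym r q)) (d-sym q p) ⟩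
    d r s + d q r + d p q ≡⟨ xy∙z≈zy∙x (d r s) (d q r) (d p q) ⟩
    d p q + d q r + d r s ≡⟨ g ⟩
    d p s                 ≡⟨ d-sym p s ⟩
    d s p                 ∎

  geodesic⇒∈I : ∀ {p q r s} → Geodesic p q r s → InInterval d p s r
  geodesic⇒∈I {p} {q} {r} {s} g = ≤-antisym upper (triangle p r s)
    where
    upper : d p r + d r s ≤ d p s
    upper = begin
      d p r + d r s         ≤⟨ +-monoˡ-≤ (d r s) (triangle p q r) ⟩
      d p q + d q r + d r s ≡⟨ g ⟩
      d p s                 ∎

  geodesic-refineˡ : ∀ {p q r s z} → Geodesic p q r s → InInterval d q r z → Geodesic p z r s
  geodesic-refineˡ {p} {q} {r} {s} {z} g z∈I = ≤-antisym upper lower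
    where
    upper : d p z + d z r + d r s ≤ d p s
    upper = begin
      d p z + d z r + d r s           ≤⟨ +-monoˡ-≤ (d r s) (+-monoˡ-≤ (d z r) (triangle p q z)) ⟩
      d p q + d q z + d z r + d r s   ≡⟨ cong (_+ d r s) (+-assoc (d p q) _ _) ⟩
      d p q + (d q z + d z r) + d r s ≡⟨ cong (λ t → d p q + t + d r s) z∈I ⟩
      d p q + d q r + d r s           ≡⟨ g ⟩
      d p s                           ∎
    lower : d p s ≤ d p z + d z r + d r s
    lower = begin
      d p s                   ≤⟨ triangle p z s ⟩
      d p z + d z s           ≤⟨ +-monoʳ-≤ (d p z) (triangle z r s) ⟩
      d p z + (d z r + d r s) ≡⟨ +-assoc (d p z) _ _ ⟨
      d p z + d z r + d r s   ∎

  geodesic-refineʳ : ∀ {p q r s z} → Geodesic p q r s → InInterval d q r z → Geodesic p q z s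
  geodesic-refineʳ g z∈I = geodesic-reverse (geodesic-refineˡ (geodesic-reverse g) (∈I-sym z∈I))

  Corner : Fin n → Fin n → Fin n → Set
  Corner a b c = ∀ z → InInterval d a b z → InInterval d a c z → z ≡ a

  corner? : ∀ a b c → Corner a b c ⊎ ∃ λ z → InInterval d a b z × InInterval d a c z × z ≢ a
  corner? a b c
    with any? (λ z → (d a z + d z b ≟ d a b) ×-dec (d a z + d z c ≟ d a c) ×-dec ¬? (z ≟ᶠ a))
  ... | yes witness = inj₂ witness
  ... | no none     = inj₁ λ z z∈Iab z∈Iac →
    decidable-stable (z ≟ᶠ a) (λ z≢a → none (z , z∈Iab , z∈Iac , z≢a))

  record Inscribed (a b c a' b' c' : Fin n) : Set where
    constructor inscribed
    field
      side-ab : Geodesic a a' b' b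
      side-ac : Geodesic a a' c' c
      side-bc : Geodesic b b' c' c

  record QuasiMedian (a b c : Fin n) : Set where
    constructor mkQuasiMedian
    field
      a' b' c'         : Fin n
      isInscribed      : Inscribed a b c a' b' c'
      isMetricTriangle : MetricTriangle d a' b' c'

  perimeter : Fin n → Fin n → Fin n → ℕ
  perimeter a b c = d a b + d a c + d b c

  module _ {a b c a' b' c' z : Fin n} (ins : Inscribed a b c a' b' c') where
    open Inscribed ins

    shrink-a : InInterval d a' b' z → InInterval d a' c' z → Inscribed a b c z b' c'
    shrink-a z∈Ia'b' z∈Ia'c' =
      inscribed (geodesic-refineˡ side-ab z∈Ia'b') (geodesic-refineˡ side-ac z∈Ia'c') side-bc

    shrink-b : InInterval d b' a' z → InInterval d b' c' z → Inscribed a b c a' z c'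
    shrink-b z∈Ib'a' z∈Ib'c' =
      inscribed (geodesic-refineʳ side-ab (∈I-sym z∈Ib'a')) side-ac (geodesic-refineˡ side-bc z∈Ib'c')

    shrink-c : InInterval d c' a' z → InInterval d c' b' z → Inscribed a b c a' b' z
    shrink-c z∈Ic'a' z∈Ic'b' =
      inscribed side-ab (geodesic-refineʳ side-ac (∈I-sym z∈Ic'a')) (geodesic-refineʳ side-bc (∈I-sym z∈Ic'b'))

  quasiMedian-below : ∀ N {a b c a' b' c'} → Inscribed a b c a' b' c' → perimeter a' b' c' < N →
                      QuasiMedian a b c
  quasiMedian-below (suc N) {a' = a'} {b'} {c'} ins (s≤s p<N)
    with corner? a' b' c' | corner? b' a' c' | corner? c' a' b'
  ... | inj₁ clean-a | inj₁ clean-b | inj₁ clean-c = mkQuasiMedian a' b' c' ins (clean-a , clean-b , clean-c)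
  ... | inj₂ (z , z∈Ia'b' , z∈Ia'c' , z≢a') | _ | _ =
    quasiMedian-below N (shrink-a ins z∈Ia'b' z∈Ia'c') (<-≤-trans shorter p<N)
    where
    shorter : perimeter z b' c' < perimeter a' b' c'
    shorter = +-monoˡ-< (d b' c') (+-mono-< (∈I⇒closerˡ z∈Ia'b' z≢a') (∈I⇒closerˡ z∈Ia'c' z≢a'))
  ... | inj₁ _ | inj₂ (z , z∈Ib'a' , z∈Ib'c' , z≢b') | _ =
    quasiMedian-below N (shrink-b ins z∈Ib'a' z∈Ib'c') (<-≤-trans shorter p<N)
    where
    shorter : perimeter a' z c' < perimeter a' b' c'
    shorter = +-mono-< (+-monoˡ-< (d a' c') (∈I⇒closerʳ (∈I-sym z∈Ib'a') z≢b'))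
                       (∈I⇒closerˡ z∈Ib'c' z≢b')
  ... | inj₁ _ | inj₁ _ | inj₂ (z , z∈Ic'a' , z∈Ic'b' , z≢c') =
    quasiMedian-below N (shrink-c ins z∈Ic'a' z∈Ic'b') (<-≤-trans shorter p<N)
    where
    shorter : perimeter a' b' z < perimeter a' b' c'
    shorter = +-mono-< (+-monoʳ-< (d a' b') (∈I⇒closerʳ (∈I-sym z∈Ic'a') z≢c'))
                       (∈I⇒closerʳ (∈I-sym z∈Ic'b') z≢c')

  quasiMedian : ∀ a b c → QuasiMedian a b c
  quasiMedian a b c = quasiMedian-below (suc (perimeter a b c))
    (inscribed (geodesic-trivial a b) (geodesic-trivial a c) (geodesic-trivial b c)) ≤-refl

  slice-equidistant : ∀ {u v k x y} → InSlice d u v k x → InSlice d u v k y → d x v ≡ d y v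
  slice-equidistant {u} {v} {x = x} {y} (x∈I , ux≡k) (y∈I , uy≡k) = +-cancelˡ-≡ (d u x) _ _ (begin-equality
    d u x + d x v ≡⟨ x∈I ⟩
    d u v         ≡⟨ y∈I ⟨
    d u y + d y v ≡⟨ cong (_+ d y v) (trans uy≡k (sym ux≡k)) ⟩
    d u x + d y v ∎)

  bow-slice-bound : ∀ {l m u v k x y x'} → BowMetric d l m →
                    InSlice d u v k x → InSlice d u v k y →
                    InInterval d u x x' → InInterval d y x x' → l < d x' x → d y x ≤ m
  bow-slice-bound {m = m} {v = v} {x = x} {y} {x'} bow x∈S y∈S x'∈Iux x'∈Iyx far =
    +-cancelʳ-≤ (d y v) _ _ (begin
      d y x + d y v           ≡⟨ cong₂ _+_ x'∈Iyx (slice-equidistant x∈S y∈S) ⟨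
      d y x' + d x' x + d x v ≤⟨ bow y x' x v x'∈Iyx (∈I-rebase x'∈Iux (proj₁ x∈S)) far ⟩
      d y v + m               ≡⟨ +-comm (d y v) m ⟩
      m + d y v               ∎)

  near-corners-bound : ∀ {l q x y x' y'} → Geodesic x x' y' y →
                       d x' y' ≤ q → d x' x ≤ l → d y' y ≤ l → d x y ≤ q + 2 * l
  near-corners-bound {l} {q} {x} {y} {x'} {y'} g x'y'≤q x'x≤l y'y≤l = begin
    d x y                     ≡⟨ g ⟨
    d x x' + d x' y' + d y' y ≤⟨ +-mono-≤ (+-mono-≤ (≤-trans (≤-reflexive (d-sym x x')) x'x≤l) x'y'≤q) y'y≤l ⟩
    l + q + l                 ≡⟨ xy∙z≈y∙xz l q l ⟩
    q + (l + l)               ≡⟨ cong (λ t → q + (l + t)) (+-identityʳ l) ⟨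
    q + 2 * l                 ∎

  bowMetric⇒thin : ∀ {l m q} → BowMetric d l m → TrianglesBounded d q → Thin d (m ⊔ (q + 2 * l))
  bowMetric⇒thin {l} {m} {q} bow bounded u v k x y x∈S y∈S with quasiMedian u x y
  ... | mkQuasiMedian u' x' y' (inscribed ux uy xy) triangle with l <? d x' x | l <? d y' y
  ... | yes far | _ = begin
    d x y           ≡⟨ d-sym x y ⟩
    d y x           ≤⟨ bow-slice-bound bow x∈S y∈S (geodesic⇒∈I ux) (geodesic⇒∈I (geodesic-reverse xy)) far ⟩
    m               ≤⟨ m≤m⊔n m _ ⟩
    m ⊔ (q + 2 * l) ∎
  ... | no _ | yes far = ≤-trans (bow-slice-bound bow y∈S x∈S (geodesic⇒∈I uy) (geodesic⇒∈I xy) far) (m≤m⊔n m _)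
  ... | no near-x | no near-y =
    ≤-trans (near-corners-bound xy (proj₁ (proj₂ (bounded u' x' y' triangle))) (≮⇒≥ near-x) (≮⇒≥ near-y))
            (m≤n⊔m m _)

proposition9 : (l m q : ℕ) (n : ℕ) (G : SimpleGraph n) (d : Fin n → Fin n → ℕ) →
    IsDistance G d → BowMetric d l m → TrianglesBounded d q →
    Thin d (m ⊔ (q + 2 * l))
proposition9 l m q n G d isDistance = bowMetric⇒thin (isDistance⇒isMetric G isDistance)
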